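{- Let $D\in\mathbb{N}$ and $\alpha,\Lambda_1,\dots,\Lambda_\alpha,V_1,V_2,V_3,\dots\in\mathbb{Z}^+$. Suppose $(\Lambda_t)_{t=1}^\alpha$ is monotone increasing, $(V_t)_{t\in\mathbb{Z}^+}$ is monotone decreasing, and $\Lambda_1\le V_1$. Let $$t_0:=\max\{1\le t\le\alpha\mid\Lambda_t\le V_1\},\qquad s_0:=\max\Bigl\{\Bigl\lceil\frac{\Lambda_1+\dots+\Lambda_{t_0}-D}{V_1}\Bigr\rceil,\,0\Bigr\},$$ and assume $V_t=V_1$ for all $1\le t\le s_0$. Define $\mathbf{S}:\mathbb{N}\to\mathbb{Z}$ by $$\mathbf{S}(s):=s-\max\{0\le t\le\alpha\mid\Lambda_1+\dots+\Lambda_t\le V_1+V_2+\dots+V_s+D\}.$$ Then $\mathbf{S}$ attains its minimum at $s_0$, and $$\mathbf{S}(s_0)=\begin{cases}s_0-t_0 & \text{if } s_0>0,\\ -\max\{0\le t\le\alpha\mid\Lambda_1+\dots+\Lambda_t\le D\} & \text{if } s_0=0.\end{cases}$$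
   Context: Empty sums are $0$. -}

module Defs where

open import Data.Nat using (ℕ; zero; suc; _+_; _∸_; _≤?_; NonZero)
open import Data.Nat.DivMod using (_/_)
open import Data.Bool using (Bool; if_then_else_)
open import Relation.Nullary.Decidable using (⌊_⌋)

psum : (ℕ → ℕ) → ℕ → ℕ
psum f zero    = zero
psum f (suc t) = psum f t + f (suc t)

largest : (ℕ → Bool) → ℕ → ℕ
largest p zero    = zero
largest p (suc n) = if p (suc n) then suc n else largest p n

ceilDiv : ℕ → (b : ℕ) → .{{_ : NonZero b}} → ℕ
ceilDiv a b = (a + (b ∸ 1)) / b

_≤ᵇ'_ : ℕ → ℕ → Bool
a ≤ᵇ' b = ⌊ a ≤? b ⌋

-- Write L(s) for the number of Λ's that fit into the budget V₁ + … + Vₛ + D, so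
-- S(s) = s − L(s). Below s₀ the budget is s V₁ + D < Λ₁ + … + Λ_{t₀}, so L(s) < t₀
-- and one more V₁ always admits the next Λ (all Λ_t ≤ V₁ for t ≤ t₀): L grows by at
-- least one per step and S does not increase. From s₀ on L(s) ≥ t₀, so the next Λ
-- exceeds V₁ ≥ V_{s+1}: L grows by at most one per step and S does not decrease.
module Submission where

open import Defs
open import Data.Nat using (ℕ; _+_; _≤_; _<_; _∸_; NonZero)
open import Data.Integer using (ℤ; +_; -_; _-_) renaming (_≤_ to _≤ℤ_)
open import Data.Product using (_×_)
open import Relation.Binary.PropositionalEquality using (_≡_)

open import Data.Nat using (zero; suc; pred; _*_; z≤n; s≤s; _≤?_; >-nonZero)
open import Data.Nat.Properties
open import Data.Nat.DivMod using (_%_; m≡m%n+[m/n]*n; m%n<n; m<n*o⇒m/o<n)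
open import Data.Bool using (true; false)
open import Data.Bool.Properties using (T-≡)
open import Data.Product using (_,_)
open import Data.Sum using (_⊎_; inj₁; inj₂; [_,_]′)
open import Function.Bundles using (Equivalence)
open import Relation.Nullary using (yes; no; contradiction)
open import Relation.Nullary.Decidable using (fromWitness; toWitness)
open import Relation.Binary.PropositionalEquality using (refl; sym; trans; cong; subst; module ≡-Reasoning)
open import Algebra.Properties.CommutativeSemigroup +-commutativeSemigroup using (xy∙z≈xz∙y)
open import Data.Integer using (_⊖_)
import Data.Integer.Properties as ℤₚ

≤⇒≤ᵇ' : ∀ {a b} → a ≤ b → (a ≤ᵇ' b) ≡ true
≤⇒≤ᵇ' a≤b = Equivalence.to T-≡ (fromWitness a≤b)

≤ᵇ'⇒≤ : ∀ {a b} → (a ≤ᵇ' b) ≡ true → a ≤ b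
≤ᵇ'⇒≤ e = toWitness (Equivalence.from T-≡ e)

largest≤ : ∀ p n → largest p n ≤ n
largest≤ p zero = z≤n
largest≤ p (suc n) with p (suc n)
... | true  = ≤-refl
... | false = m≤n⇒m≤1+n (largest≤ p n)

≤-largest : ∀ p {n k} → k ≤ n → p k ≡ true → k ≤ largest p n
≤-largest p {zero} k≤0 _ = k≤0
≤-largest p {suc n} k≤1+n pk with p (suc n) in eq
... | true = k≤1+n
... | false with m≤n⇒m<n∨m≡n k≤1+n
...   | inj₁ k<1+n = ≤-largest p (≤-pred k<1+n) pk
...   | inj₂ refl  = contradiction (trans (sym pk) eq) λ ()

largest-true : ∀ p n → largest p n ≡ 0 ⊎ p (largest p n) ≡ true
largest-true p zero = inj₁ refl
largest-true p (suc n) with p (suc n) in eq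
... | true  = inj₂ eq
... | false = largest-true p n

psum-mono-≤ : ∀ f {i j} → i ≤ j → psum f i ≤ psum f j
psum-mono-≤ f {j = zero} z≤n = ≤-refl
psum-mono-≤ f {j = suc j} i≤1+j with m≤n⇒m<n∨m≡n i≤1+j
... | inj₁ i<1+j = ≤-trans (psum-mono-≤ f (≤-pred i<1+j)) (m≤m+n _ _)
... | inj₂ refl  = ≤-refl

psum-const : ∀ f c n → (∀ t → 1 ≤ t → t ≤ n → f t ≡ c) → psum f n ≡ n * c
psum-const f c zero _ = refl
psum-const f c (suc n) f≡c = begin
  psum f n + f (suc n) ≡⟨ cong (_+ f (suc n)) (psum-const f c n λ t 1≤t t≤n → f≡c t 1≤t (m≤n⇒m≤1+n t≤n)) ⟩
  n * c + f (suc n)    ≡⟨ cong (_+_ (n * c)) (f≡c (suc n) (s≤s z≤n) ≤-refl) ⟩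
  n * c + c            ≡⟨ +-comm (n * c) c ⟩
  suc n * c            ∎
  where open ≡-Reasoning

maxPrefix : (ℕ → ℕ) → ℕ → ℕ → ℕ
maxPrefix g n x = largest (λ t → psum g t ≤ᵇ' x) n

module _ (g : ℕ → ℕ) (n : ℕ) where

  maxPrefix≤ : ∀ x → maxPrefix g n x ≤ n
  maxPrefix≤ x = largest≤ _ n

  psum-maxPrefix≤ : ∀ x → psum g (maxPrefix g n x) ≤ x
  psum-maxPrefix≤ x = [ (λ e → subst (λ t → psum g t ≤ x) (sym e) z≤n) , ≤ᵇ'⇒≤ ]′ (largest-true _ n)

  ≤-maxPrefix : ∀ {x k} → k ≤ n → psum g k ≤ x → k ≤ maxPrefix g n x
  ≤-maxPrefix k≤n fits = ≤-largest _ k≤n (≤⇒≤ᵇ' fits)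

  maxPrefix-mono-≤ : ∀ {x y} → x ≤ y → maxPrefix g n x ≤ maxPrefix g n y
  maxPrefix-mono-≤ {x} x≤y = ≤-maxPrefix (maxPrefix≤ x) (≤-trans (psum-maxPrefix≤ x) x≤y)

  maxPrefix-< : ∀ {x m} → x < psum g m → maxPrefix g n x < m
  maxPrefix-< {x} {m} x<psum = ≰⇒> λ m≤k →
    <⇒≱ x<psum (≤-trans (psum-mono-≤ g m≤k) (psum-maxPrefix≤ x))

  <-psum-suc-maxPrefix : ∀ x → maxPrefix g n x < n → x < psum g (suc (maxPrefix g n x))
  <-psum-suc-maxPrefix x k<n = ≰⇒> λ fits →
    <⇒≱ (n<1+n _) (≤-maxPrefix k<n fits)

ceilDiv-least : ∀ m n o .{{_ : NonZero n}} → m ≤ o * n → ceilDiv m n ≤ o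
ceilDiv-least m n o m≤o*n = ≤-pred (m<n*o⇒m/o<n (begin-strict
  m + (n ∸ 1)           ≤⟨ +-monoˡ-≤ (n ∸ 1) m≤o*n ⟩
  o * n + pred n        <⟨ n<1+n _ ⟩
  suc (o * n + pred n)  ≡⟨ +-suc (o * n) (pred n) ⟨
  o * n + suc (pred n)  ≡⟨ cong (_+_ (o * n)) (suc-pred n) ⟩
  o * n + n             ≡⟨ +-comm (o * n) n ⟩
  suc o * n             ∎))
  where open ≤-Reasoning

≤-ceilDiv-* : ∀ m n .{{_ : NonZero n}} → m ≤ ceilDiv m n * n
≤-ceilDiv-* m n = +-cancelʳ-≤ (pred n) m (q * n) (begin
  m + pred n                ≡⟨ m≡m%n+[m/n]*n (m + pred n) n ⟩
  (m + pred n) % n + q * n  ≤⟨ +-monoˡ-≤ (q * n) (<⇒≤pred (m%n<n (m + pred n) n)) ⟩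
  pred n + q * n            ≡⟨ +-comm (pred n) (q * n) ⟩
  q * n + pred n            ∎)
  where
    open ≤-Reasoning
    q = ceilDiv m n

[+m]-[+n]≤[+o]-[+p] : ∀ m n o p → m + p ≤ o + n → + m - + n ≤ℤ + o - + p
[+m]-[+n]≤[+o]-[+p] m n o p m+p≤o+n = begin
  + m - + n          ≡⟨ ℤₚ.[+m]-[+n]≡m⊖n m n ⟩
  m ⊖ n              ≡⟨ ℤₚ.+-cancelˡ-⊖ p m n ⟨
  (p + m) ⊖ (p + n)  ≤⟨ ℤₚ.⊖-monoˡ-≤ (p + n) (≤-trans (≤-reflexive (+-comm p m)) m+p≤o+n) ⟩
  (o + n) ⊖ (p + n)  ≡⟨ cong₂ _⊖_ (+-comm o n) (+-comm p n) ⟩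
  (n + o) ⊖ (n + p)  ≡⟨ ℤₚ.+-cancelˡ-⊖ n o p ⟩
  o ⊖ p              ≡⟨ ℤₚ.[+m]-[+n]≡m⊖n o p ⟨
  + o - + p          ∎
  where
    open ℤₚ.≤-Reasoning
    open Relation.Binary.PropositionalEquality using (cong₂)

module _ {f : ℕ → ℕ} {m : ℕ} where

  f[m+d]≤d+f[m] : (∀ s → m ≤ s → f (suc s) ≤ suc (f s)) → ∀ d → f (m + d) ≤ d + f m
  f[m+d]≤d+f[m] _ zero = ≤-reflexive (cong f (+-identityʳ m))
  f[m+d]≤d+f[m] slow (suc d) = begin
    f (m + suc d)    ≡⟨ cong f (+-suc m d) ⟩
    f (suc (m + d))  ≤⟨ slow (m + d) (m≤m+n m d) ⟩
    suc (f (m + d))  ≤⟨ s≤s (f[m+d]≤d+f[m] slow d) ⟩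
    suc d + f m      ∎
    where open ≤-Reasoning

  d+f[s]≤f[s+d] : (∀ s → s < m → suc (f s) ≤ f (suc s)) → ∀ s d → s + d ≤ m → d + f s ≤ f (s + d)
  d+f[s]≤f[s+d] _ s zero _ = ≤-reflexive (cong f (sym (+-identityʳ s)))
  d+f[s]≤f[s+d] fast s (suc d) s+1+d≤m = begin
    suc d + f s      ≤⟨ s≤s (d+f[s]≤f[s+d] fast s d (<⇒≤ s+d<m)) ⟩
    suc (f (s + d))  ≤⟨ fast (s + d) s+d<m ⟩
    f (suc (s + d))  ≡⟨ cong f (+-suc s d) ⟨
    f (s + suc d)    ∎
    where
      open ≤-Reasoning
      s+d<m : s + d < m
      s+d<m = subst (_≤ m) (+-suc s d) s+1+d≤m

  m+f[s]≤s+f[m] : (∀ s → s < m → suc (f s) ≤ f (suc s)) → (∀ s → m ≤ s → f (suc s) ≤ suc (f s)) →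
                  ∀ s → m + f s ≤ s + f m
  m+f[s]≤s+f[m] fast slow s with m ≤? s
  ... | yes m≤s = begin
    m + f s                ≡⟨ cong (λ t → m + f t) (m+[n∸m]≡n m≤s) ⟨
    m + f (m + (s ∸ m))    ≤⟨ +-monoʳ-≤ m (f[m+d]≤d+f[m] slow (s ∸ m)) ⟩
    m + ((s ∸ m) + f m)    ≡⟨ +-assoc m (s ∸ m) (f m) ⟨
    (m + (s ∸ m)) + f m    ≡⟨ cong (_+ f m) (m+[n∸m]≡n m≤s) ⟩
    s + f m                ∎
    where open ≤-Reasoning
  ... | no m≰s = begin
    m + f s                ≡⟨ cong (_+ f s) s+[m∸s]≡m ⟨
    (s + (m ∸ s)) + f s    ≡⟨ +-assoc s (m ∸ s) (f s) ⟩
    s + ((m ∸ s) + f s)    ≤⟨ +-monoʳ-≤ s (d+f[s]≤f[s+d] fast s (m ∸ s) (≤-reflexive s+[m∸s]≡m)) ⟩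
    s + f (s + (m ∸ s))    ≡⟨ cong (λ t → s + f t) s+[m∸s]≡m ⟩
    s + f m                ∎
    where
      open ≤-Reasoning
      s+[m∸s]≡m : s + (m ∸ s) ≡ m
      s+[m∸s]≡m = m+[n∸m]≡n (<⇒≤ (≰⇒> m≰s))

module Schedule (D α : ℕ) (Λ V : ℕ → ℕ) (1≤α : 1 ≤ α)
  (Λ-mono : ∀ i j → 1 ≤ i → i ≤ j → j ≤ α → Λ i ≤ Λ j)
  (V-anti : ∀ i j → 1 ≤ i → i ≤ j → V j ≤ V i)
  (Λ₁≤V₁ : Λ 1 ≤ V 1) .{{_ : NonZero (V 1)}} where

  t₀ : ℕ
  t₀ = largest (λ t → Λ t ≤ᵇ' V 1) α

  s₀ : ℕ
  s₀ = ceilDiv (psum Λ t₀ ∸ D) (V 1)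

  budget : ℕ → ℕ
  budget s = psum V s + D

  fits : ℕ → ℕ
  fits s = maxPrefix Λ α (budget s)

  t₀≤α : t₀ ≤ α
  t₀≤α = largest≤ _ α

  1≤t₀ : 1 ≤ t₀
  1≤t₀ = ≤-largest _ 1≤α (≤⇒≤ᵇ' Λ₁≤V₁)

  Λ≤V₁ : ∀ t → 1 ≤ t → t ≤ t₀ → Λ t ≤ V 1
  Λ≤V₁ t 1≤t t≤t₀ = ≤-trans (Λ-mono t t₀ 1≤t t≤t₀ t₀≤α) Λt₀≤V₁
    where
      Λt₀≤V₁ : Λ t₀ ≤ V 1
      Λt₀≤V₁ = [ (λ t₀≡0 → contradiction (subst (1 ≤_) t₀≡0 1≤t₀) λ ()) , ≤ᵇ'⇒≤ ]′ (largest-true _ α)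

  V₁<Λ : ∀ t → t₀ < t → t ≤ α → V 1 < Λ t
  V₁<Λ t t₀<t t≤α = ≰⇒> λ Λt≤V₁ → <⇒≱ t₀<t (≤-largest _ t≤α (≤⇒≤ᵇ' Λt≤V₁))

  budget-mono-≤ : ∀ {s s′} → s ≤ s′ → budget s ≤ budget s′
  budget-mono-≤ s≤s′ = +-monoˡ-≤ D (psum-mono-≤ V s≤s′)

  budget-suc : ∀ s → budget (suc s) ≡ budget s + V (suc s)
  budget-suc s = xy∙z≈xz∙y (psum V s) (V (suc s)) D

  budget-suc-< : ∀ s m → t₀ ≤ m → suc m ≤ α → budget s < psum Λ m → budget (suc s) < psum Λ (suc m)
  budget-suc-< s m t₀≤m 1+m≤α budget<psum = begin-strict
    budget (suc s)        ≡⟨ budget-suc s ⟩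
    budget s + V (suc s)  <⟨ +-mono-<-≤ budget<psum V≤Λ ⟩
    psum Λ m + Λ (suc m)  ∎
    where
      open ≤-Reasoning
      V≤Λ : V (suc s) ≤ Λ (suc m)
      V≤Λ = ≤-trans (V-anti 1 (suc s) (s≤s z≤n) (s≤s z≤n)) (<⇒≤ (V₁<Λ (suc m) (s≤s t₀≤m) 1+m≤α))

  module _ (V-flat : ∀ t → 1 ≤ t → t ≤ s₀ → V t ≡ V 1) where

    budget-flat : ∀ s → s ≤ s₀ → budget s ≡ D + s * V 1
    budget-flat s s≤s₀ = begin
      psum V s + D   ≡⟨ cong (_+ D) (psum-const V (V 1) s λ t 1≤t t≤s → V-flat t 1≤t (≤-trans t≤s s≤s₀)) ⟩
      s * V 1 + D    ≡⟨ +-comm (s * V 1) D ⟩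
      D + s * V 1    ∎
      where open ≡-Reasoning

    t₀≤fits-s₀ : t₀ ≤ fits s₀
    t₀≤fits-s₀ = ≤-maxPrefix Λ α t₀≤α (begin
      psum Λ t₀              ≤⟨ m≤n+m∸n (psum Λ t₀) D ⟩
      D + (psum Λ t₀ ∸ D)    ≤⟨ +-monoʳ-≤ D (≤-ceilDiv-* (psum Λ t₀ ∸ D) (V 1)) ⟩
      D + s₀ * V 1           ≡⟨ budget-flat s₀ ≤-refl ⟨
      budget s₀              ∎)
      where open ≤-Reasoning

    budget<psum-t₀ : ∀ s → s < s₀ → budget s < psum Λ t₀
    budget<psum-t₀ s s<s₀ = ≰⇒> λ psum≤budget →
      <⇒≱ s<s₀ (ceilDiv-least _ (V 1) s
        (m≤n+o⇒m∸n≤o (psum Λ t₀) D (≤-trans psum≤budget (≤-reflexive (budget-flat s (<⇒≤ s<s₀))))))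

    suc-fits≤ : ∀ s → s < s₀ → suc (fits s) ≤ fits (suc s)
    suc-fits≤ s s<s₀ = ≤-maxPrefix Λ α (≤-trans fits<t₀ t₀≤α) (begin
      psum Λ (fits s) + Λ (suc (fits s))  ≤⟨ +-mono-≤ (psum-maxPrefix≤ Λ α (budget s)) (Λ≤V₁ _ (s≤s z≤n) fits<t₀) ⟩
      budget s + V 1                      ≡⟨ cong (_+_ (budget s)) (V-flat (suc s) (s≤s z≤n) s<s₀) ⟨
      budget s + V (suc s)                ≡⟨ budget-suc s ⟨
      budget (suc s)                      ∎)
      where
        open ≤-Reasoning
        fits<t₀ : fits s < t₀
        fits<t₀ = maxPrefix-< Λ α (budget<psum-t₀ s s<s₀)

    fits-suc≤ : ∀ s → s₀ ≤ s → fits (suc s) ≤ suc (fits s)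
    fits-suc≤ s s₀≤s with suc (suc (fits s)) ≤? α
    ... | no 2+fits≰α = ≤-trans (maxPrefix≤ Λ α _) (≤-pred (≰⇒> 2+fits≰α))
    ... | yes 2+fits≤α = ≤-pred (maxPrefix-< Λ α
          (budget-suc-< s (suc (fits s)) t₀≤1+fits 2+fits≤α (<-psum-suc-maxPrefix Λ α (budget s) fits<α)))
      where
        fits<α : fits s < α
        fits<α = ≤-trans (n≤1+n _) 2+fits≤α
        t₀≤1+fits : t₀ ≤ suc (fits s)
        t₀≤1+fits = m≤n⇒m≤1+n (≤-trans t₀≤fits-s₀ (maxPrefix-mono-≤ Λ α (budget-mono-≤ s₀≤s)))

    fits-suc≤t₀ : ∀ s → s < s₀ → fits (suc s) ≤ t₀
    fits-suc≤t₀ s s<s₀ with suc t₀ ≤? α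
    ... | no 1+t₀≰α = ≤-trans (maxPrefix≤ Λ α _) (≤-pred (≰⇒> 1+t₀≰α))
    ... | yes 1+t₀≤α = ≤-pred (maxPrefix-< Λ α (budget-suc-< s t₀ ≤-refl 1+t₀≤α (budget<psum-t₀ s s<s₀)))

    fits-s₀≡t₀ : 0 < s₀ → fits s₀ ≡ t₀
    fits-s₀≡t₀ 0<s₀ = ≤-antisym fits-s₀≤t₀ t₀≤fits-s₀
      where
        1+pred≡s₀ : suc (pred s₀) ≡ s₀
        1+pred≡s₀ = suc-pred s₀ {{>-nonZero 0<s₀}}
        fits-s₀≤t₀ : fits s₀ ≤ t₀
        fits-s₀≤t₀ = subst (λ s → fits s ≤ t₀) 1+pred≡s₀ (fits-suc≤t₀ (pred s₀) (≤-reflexive 1+pred≡s₀))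

lemma5p1 : (D α : ℕ) (Λ V : ℕ → ℕ) →
    1 ≤ α →
    (∀ t → 1 ≤ t → t ≤ α → 1 ≤ Λ t) →
    (∀ t → 1 ≤ t → 1 ≤ V t) →
    (∀ i j → 1 ≤ i → i ≤ j → j ≤ α → Λ i ≤ Λ j) →
    (∀ i j → 1 ≤ i → i ≤ j → V j ≤ V i) →
    Λ 1 ≤ V 1 →
    .{{_ : NonZero (V 1)}} →
    let t₀ = largest (λ t → Λ t ≤ᵇ' V 1) α
        s₀ = ceilDiv (psum Λ t₀ ∸ D) (V 1)
        S : ℕ → ℤ
        S s = + s - + largest (λ t → psum Λ t ≤ᵇ' (psum V s + D)) α
    in (∀ t → 1 ≤ t → t ≤ s₀ → V t ≡ V 1) →
       (∀ s → S s₀ ≤ℤ S s)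
       × (0 < s₀ → S s₀ ≡ + s₀ - + t₀)
       × (s₀ ≡ 0 → S s₀ ≡ - (+ largest (λ t → psum Λ t ≤ᵇ' D) α))
lemma5p1 D α Λ V 1≤α _ _ Λ-mono V-anti Λ₁≤V₁ V-flat =
    (λ s → [+m]-[+n]≤[+o]-[+p] s₀ (fits s₀) s (fits s)
             (m+f[s]≤s+f[m] (suc-fits≤ V-flat) (fits-suc≤ V-flat) s))
  , (λ 0<s₀ → cong (λ t → + s₀ - + t) (fits-s₀≡t₀ V-flat 0<s₀))
  , (λ s₀≡0 → subst (λ s → + s - + fits s ≡ - (+ fits 0)) (sym s₀≡0) (ℤₚ.+-identityˡ _))
  where open Schedule D α Λ V 1≤α Λ-mono V-anti Λ₁≤V₁
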